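{- Any path object category $\mathcal E$ may be equipped with the structure of a cloven weak factorisation system whose cloven $\mathcal L$-maps are precisely (in bijection with) the strong deformation retracts.
   Context: Path object category: finitely complete $\mathcal E$ with (Axiom 1) a pullback-preserving endofunctor $M$ and natural $s,t\colon MX\to X$, $r\colon X\to MX$, $m\colon MX\,{}_{s_X}\!\times_{t_X}MX\to MX$, $\tau\colon MX\to MX$ making $(X,MX,s_X,t_X,r_X,m_X)$ an internal category ($s_Xm_X=s_X\pi_2$, $t_Xm_X=t_X\pi_1$) with $\tau_X$ an involution giving an identity-on-objects isomorphism with the opposite category; (Axiom 2) a strength $\alpha_{X,Y}\colon MX\times Y\to M(X\times Y)$ for which $s,t,r,m,\tau$ are strong; (Axiom 3) a strong natural $\eta\colon M\Rightarrow MM$ with $s_{MX}\eta_X=1$, $t_{MX}\eta_X=r_Xt_X$, $Ms_X\eta_X=1$, $Mt_X\eta_X=\alpha_{1,X}(M!,t_X)$, $\eta_Xr_X=r_{MX}r_X$. A homotopy $\theta\colon f\Rightarrow g\colon X\to Y$ is a map $\theta\colon X\to MY$ with $s_Y\theta=f$, $t_Y\theta=g$; the identity homotopy on $f$ is $1_f=r_Yf$; for $u\colon W\to X$, $\theta.u=\theta u$. A strong deformation retraction for $f\colon X\to Y$ is $k\colon Y\to X$ with $kf=1_X$ together with a homotopy $\theta\colon1_Y\Rightarrow fk$ with $\theta.f=1_f$; a strong deformation retract is a map equipped with one. Cloven w.f.s.: for each $f\colon X\to Y$ a factorisation $f=\rho_f\lambda_f$ through $Pf$; for each commutative square $gh=kf$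 a map $P(h,k)\colon Pf\to Pg$ with $P(h,k)\lambda_f=\lambda_gh$, $\rho_gP(h,k)=k\rho_f$, functorial; fillers $\sigma_f\colon Pf\to P\lambda_f$, $\pi_f\colon P\rho_f\to Pf$ with $\sigma_f\lambda_f=\lambda_{\lambda_f}$, $\rho_{\lambda_f}\sigma_f=1$, $\pi_f\lambda_{\rho_f}=1$, $\rho_f\pi_f=\rho_{\rho_f}$. A cloven $\mathcal L$-map structure on $f$ is $s\colon Y\to Pf$ with $sf=\lambda_f$, $\rho_fs=1_Y$. -}

module Defs where

open import Level using (Level; _⊔_) renaming (suc to lsuc)
open import Relation.Binary.PropositionalEquality using (_≡_)

record Category (o ℓ : Level) : Set (lsuc (o ⊔ ℓ)) where
  infixr 9 _∘_
  field
    Obj       : Set o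
    Hom       : Obj → Obj → Set ℓ
    id        : ∀ {A} → Hom A A
    _∘_       : ∀ {A B C} → Hom B C → Hom A B → Hom A C
    identityˡ : ∀ {A B} {f : Hom A B} → id ∘ f ≡ f
    identityʳ : ∀ {A B} {f : Hom A B} → f ∘ id ≡ f
    assoc     : ∀ {A B C D} {f : Hom A B} {g : Hom B C} {h : Hom C D} →
                (h ∘ g) ∘ f ≡ h ∘ (g ∘ f)

module _ {o ℓ} (𝒞 : Category o ℓ) where
  open Category 𝒞

  record IsTerminal (T : Obj) : Set (o ⊔ ℓ) where
    field
      !        : ∀ {A} → Hom A T
      !-unique : ∀ {A} (h : Hom A T) → h ≡ !

  record Product (A B : Obj) : Set (o ⊔ ℓ) where
    field
      A×B   : Obj
      π₁    : Hom A×B A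
      π₂    : Hom A×B B
      ⟨_,_⟩ : ∀ {Z} → Hom Z A → Hom Z B → Hom Z A×B
      π₁∘⟨⟩ : ∀ {Z} {f : Hom Z A} {g : Hom Z B} → π₁ ∘ ⟨ f , g ⟩ ≡ f
      π₂∘⟨⟩ : ∀ {Z} {f : Hom Z A} {g : Hom Z B} → π₂ ∘ ⟨ f , g ⟩ ≡ g
      ⟨⟩-unique : ∀ {Z} {f : Hom Z A} {g : Hom Z B} (h : Hom Z A×B) →
                  π₁ ∘ h ≡ f → π₂ ∘ h ≡ g → h ≡ ⟨ f , g ⟩

  record IsPullback {P A B C : Obj} (f : Hom A C) (g : Hom B C)
                    (p₁ : Hom P A) (p₂ : Hom P B) : Set (o ⊔ ℓ) where
    field
      commute   : f ∘ p₁ ≡ g ∘ p₂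
      universal : ∀ {Z} (h : Hom Z A) (k : Hom Z B) → f ∘ h ≡ g ∘ k → Hom Z P
      p₁∘universal : ∀ {Z} {h : Hom Z A} {k : Hom Z B} (eq : f ∘ h ≡ g ∘ k) →
                     p₁ ∘ universal h k eq ≡ h
      p₂∘universal : ∀ {Z} {h : Hom Z A} {k : Hom Z B} (eq : f ∘ h ≡ g ∘ k) →
                     p₂ ∘ universal h k eq ≡ k
      unique    : ∀ {Z} {h : Hom Z A} {k : Hom Z B} (eq : f ∘ h ≡ g ∘ k)
                  (u : Hom Z P) → p₁ ∘ u ≡ h → p₂ ∘ u ≡ k → u ≡ universal h k eq

  record Pullback {A B C : Obj} (f : Hom A C) (g : Hom B C) : Set (o ⊔ ℓ) where
    field
      P          : Obj
      p₁         : Hom P A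
      p₂         : Hom P B
      isPullback : IsPullback f g p₁ p₂

  record FinitelyComplete : Set (o ⊔ ℓ) where
    field
      ⊤          : Obj
      ⊤-terminal : IsTerminal ⊤
      product    : ∀ A B → Product A B
      pullback   : ∀ {A B C} (f : Hom A C) (g : Hom B C) → Pullback f g

  record ClovenWFS : Set (o ⊔ ℓ) where
    field
      P    : ∀ {X Y} → Hom X Y → Obj
      lam  : ∀ {X Y} (f : Hom X Y) → Hom X (P f)
      rho  : ∀ {X Y} (f : Hom X Y) → Hom (P f) Y
      fact : ∀ {X Y} (f : Hom X Y) → rho f ∘ lam f ≡ f
      Pmap : ∀ {X Y X' Y'} {f : Hom X Y} {g : Hom X' Y'} (h : Hom X X') (k : Hom Y Y') →
             g ∘ h ≡ k ∘ f → Hom (P f) (P g)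
      Pmap-lam : ∀ {X Y X' Y'} {f : Hom X Y} {g : Hom X' Y'} {h : Hom X X'} {k : Hom Y Y'}
                 (sq : g ∘ h ≡ k ∘ f) → Pmap h k sq ∘ lam f ≡ lam g ∘ h
      rho-Pmap : ∀ {X Y X' Y'} {f : Hom X Y} {g : Hom X' Y'} {h : Hom X X'} {k : Hom Y Y'}
                 (sq : g ∘ h ≡ k ∘ f) → rho g ∘ Pmap h k sq ≡ k ∘ rho f
      Pmap-id  : ∀ {X Y} {f : Hom X Y} (sq : f ∘ id ≡ id ∘ f) → Pmap id id sq ≡ id
      Pmap-∘   : ∀ {X Y X' Y' X'' Y''} {f : Hom X Y} {g : Hom X' Y'} {e : Hom X'' Y''}
                 {h : Hom X X'} {k : Hom Y Y'} {h' : Hom X' X''} {k' : Hom Y' Y''}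
                 (sq : g ∘ h ≡ k ∘ f) (sq' : e ∘ h' ≡ k' ∘ g)
                 (sq'' : e ∘ (h' ∘ h) ≡ (k' ∘ k) ∘ f) →
                 Pmap (h' ∘ h) (k' ∘ k) sq'' ≡ Pmap h' k' sq' ∘ Pmap h k sq
      σ     : ∀ {X Y} (f : Hom X Y) → Hom (P f) (P (lam f))
      σ-lam : ∀ {X Y} (f : Hom X Y) → σ f ∘ lam f ≡ lam (lam f)
      rho-σ : ∀ {X Y} (f : Hom X Y) → rho (lam f) ∘ σ f ≡ id
      π     : ∀ {X Y} (f : Hom X Y) → Hom (P (rho f)) (P f)
      π-lam : ∀ {X Y} (f : Hom X Y) → π f ∘ lam (rho f) ≡ id
      rho-π : ∀ {X Y} (f : Hom X Y) → rho f ∘ π f ≡ rho (rho f)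

  record LMapStr (W : ClovenWFS) {X Y : Obj} (f : Hom X Y) : Set ℓ where
    open ClovenWFS W
    field
      sec     : Hom Y (P f)
      sec-lam : sec ∘ f ≡ lam f
      rho-sec : rho f ∘ sec ≡ id

module FCNotation {o ℓ} (𝒞 : Category o ℓ) (fc : FinitelyComplete 𝒞) where
  open Category 𝒞
  open FinitelyComplete fc public using (⊤)

  ! : ∀ {A} → Hom A ⊤
  ! = IsTerminal.! (FinitelyComplete.⊤-terminal fc)

  infixr 7 _×_
  _×_ : Obj → Obj → Obj
  A × B = Product.A×B (FinitelyComplete.product fc A B)

  π₁ : ∀ {A B} → Hom (A × B) A
  π₁ {A} {B} = Product.π₁ (FinitelyComplete.product fc A B)

  π₂ : ∀ {A B} → Hom (A × B) B
  π₂ {A} {B} = Product.π₂ (FinitelyComplete.product fc A B)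

  ⟨_,_⟩ : ∀ {Z A B} → Hom Z A → Hom Z B → Hom Z (A × B)
  ⟨_,_⟩ {A = A} {B} = Product.⟨_,_⟩ (FinitelyComplete.product fc A B)

  infixr 8 _⊗_
  _⊗_ : ∀ {A B A' B'} → Hom A A' → Hom B B' → Hom (A × B) (A' × B')
  f ⊗ g = ⟨ f ∘ π₁ , g ∘ π₂ ⟩

  assocʳ : ∀ {A B C} → Hom ((A × B) × C) (A × (B × C))
  assocʳ = ⟨ π₁ ∘ π₁ , ⟨ π₂ ∘ π₁ , π₂ ⟩ ⟩

  PB : ∀ {A B C} → Hom A C → Hom B C → Obj
  PB f g = Pullback.P (FinitelyComplete.pullback fc f g)

  pb₁ : ∀ {A B C} (f : Hom A C) (g : Hom B C) → Hom (PB f g) A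
  pb₁ f g = Pullback.p₁ (FinitelyComplete.pullback fc f g)

  pb₂ : ∀ {A B C} (f : Hom A C) (g : Hom B C) → Hom (PB f g) B
  pb₂ f g = Pullback.p₂ (FinitelyComplete.pullback fc f g)

module _ {o ℓ} (𝒞 : Category o ℓ) (fc : FinitelyComplete 𝒞) where
  open Category 𝒞
  open FCNotation 𝒞 fc

  record PathObjectCategory : Set (o ⊔ ℓ) where
    field
      M    : Obj → Obj
      M₁   : ∀ {A B} → Hom A B → Hom (M A) (M B)
      M-id : ∀ {A} → M₁ (id {A}) ≡ id
      M-∘  : ∀ {A B C} {f : Hom A B} {g : Hom B C} → M₁ (g ∘ f) ≡ M₁ g ∘ M₁ f
      M-pullback : ∀ {P A B C} {f : Hom A C} {g : Hom B C} {p₁ : Hom P A} {p₂ : Hom P B} →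
                   IsPullback 𝒞 f g p₁ p₂ →
                   IsPullback 𝒞 (M₁ f) (M₁ g) (M₁ p₁) (M₁ p₂)

      s : ∀ X → Hom (M X) X
      t : ∀ X → Hom (M X) X
      r : ∀ X → Hom X (M X)
      -- m_X : MX ×_{s_X, t_X} MX → MX   (first component is the later path)
      m : ∀ X → Hom (PB (s X) (t X)) (M X)
      τ : ∀ X → Hom (M X) (M X)

      s-nat : ∀ {X Y} (f : Hom X Y) → s Y ∘ M₁ f ≡ f ∘ s X
      t-nat : ∀ {X Y} (f : Hom X Y) → t Y ∘ M₁ f ≡ f ∘ t X
      r-nat : ∀ {X Y} (f : Hom X Y) → M₁ f ∘ r X ≡ r Y ∘ f
      τ-nat : ∀ {X Y} (f : Hom X Y) → M₁ f ∘ τ X ≡ τ Y ∘ M₁ f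
      m-nat : ∀ {X Y} (f : Hom X Y) (w : Hom (PB (s X) (t X)) (PB (s Y) (t Y))) →
              pb₁ (s Y) (t Y) ∘ w ≡ M₁ f ∘ pb₁ (s X) (t X) →
              pb₂ (s Y) (t Y) ∘ w ≡ M₁ f ∘ pb₂ (s X) (t X) →
              m Y ∘ w ≡ M₁ f ∘ m X

      s-r : ∀ X → s X ∘ r X ≡ id
      t-r : ∀ X → t X ∘ r X ≡ id
      s-m : ∀ X → s X ∘ m X ≡ s X ∘ pb₂ (s X) (t X)
      t-m : ∀ X → t X ∘ m X ≡ t X ∘ pb₁ (s X) (t X)
      m-unitˡ : ∀ {X Z} (a : Hom Z (M X)) (w : Hom Z (PB (s X) (t X))) →
                pb₁ (s X) (t X) ∘ w ≡ r X ∘ (t X ∘ a) →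
                pb₂ (s X) (t X) ∘ w ≡ a →
                m X ∘ w ≡ a
      m-unitʳ : ∀ {X Z} (a : Hom Z (M X)) (w : Hom Z (PB (s X) (t X))) →
                pb₁ (s X) (t X) ∘ w ≡ a →
                pb₂ (s X) (t X) ∘ w ≡ r X ∘ (s X ∘ a) →
                m X ∘ w ≡ a
      -- associativity, stated on generalised elements  m(m(a,b),c) = m(a,m(b,c))
      m-assoc : ∀ {X Z} (a b c : Hom Z (M X)) (w₁ w₂ w₃ w₄ : Hom Z (PB (s X) (t X))) →
                pb₁ (s X) (t X) ∘ w₁ ≡ a → pb₂ (s X) (t X) ∘ w₁ ≡ b →
                pb₁ (s X) (t X) ∘ w₂ ≡ m X ∘ w₁ → pb₂ (s X) (t X) ∘ w₂ ≡ c →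
                pb₁ (s X) (t X) ∘ w₃ ≡ b → pb₂ (s X) (t X) ∘ w₃ ≡ c →
                pb₁ (s X) (t X) ∘ w₄ ≡ a → pb₂ (s X) (t X) ∘ w₄ ≡ m X ∘ w₃ →
                m X ∘ w₂ ≡ m X ∘ w₄
      -- τ is an involutive identity-on-objects isomorphism with the opposite
      τ-invol : ∀ X → τ X ∘ τ X ≡ id
      s-τ : ∀ X → s X ∘ τ X ≡ t X
      t-τ : ∀ X → t X ∘ τ X ≡ s X
      τ-r : ∀ X → τ X ∘ r X ≡ r X
      τ-m : ∀ X (w : Hom (PB (s X) (t X)) (PB (s X) (t X))) →
            pb₁ (s X) (t X) ∘ w ≡ τ X ∘ pb₂ (s X) (t X) →
            pb₂ (s X) (t X) ∘ w ≡ τ X ∘ pb₁ (s X) (t X) →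
            τ X ∘ m X ≡ m X ∘ w

      α : ∀ X Y → Hom (M X × Y) (M (X × Y))
      α-nat : ∀ {X X' Y Y'} (f : Hom X X') (g : Hom Y Y') →
              M₁ (f ⊗ g) ∘ α X Y ≡ α X' Y' ∘ (M₁ f ⊗ g)
      α-unit  : ∀ X → M₁ π₁ ∘ α X ⊤ ≡ π₁
      α-assoc : ∀ X Y Z → M₁ assocʳ ∘ (α (X × Y) Z ∘ (α X Y ⊗ id)) ≡ α X (Y × Z) ∘ assocʳ
      s-strong : ∀ X Y → s (X × Y) ∘ α X Y ≡ s X ⊗ id
      t-strong : ∀ X Y → t (X × Y) ∘ α X Y ≡ t X ⊗ id
      r-strong : ∀ X Y → α X Y ∘ (r X ⊗ id) ≡ r (X × Y)
      τ-strong : ∀ X Y → τ (X × Y) ∘ α X Y ≡ α X Y ∘ (τ X ⊗ id)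
      m-strong : ∀ X Y (w : Hom (PB (s X) (t X) × Y) (PB (s (X × Y)) (t (X × Y)))) →
                 pb₁ (s (X × Y)) (t (X × Y)) ∘ w ≡ α X Y ∘ (pb₁ (s X) (t X) ⊗ id) →
                 pb₂ (s (X × Y)) (t (X × Y)) ∘ w ≡ α X Y ∘ (pb₂ (s X) (t X) ⊗ id) →
                 m (X × Y) ∘ w ≡ α X Y ∘ (m X ⊗ id)

      η : ∀ X → Hom (M X) (M (M X))
      η-nat    : ∀ {X Y} (f : Hom X Y) → M₁ (M₁ f) ∘ η X ≡ η Y ∘ M₁ f
      η-strong : ∀ X Y → η (X × Y) ∘ α X Y ≡ M₁ (α X Y) ∘ (α (M X) Y ∘ (η X ⊗ id))
      η-s  : ∀ X → s (M X) ∘ η X ≡ id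
      η-t  : ∀ X → t (M X) ∘ η X ≡ r X ∘ t X
      η-Ms : ∀ X → M₁ (s X) ∘ η X ≡ id
      -- α_{1,X}(M!, t_X), composed with the canonical iso M(1×X) ≅ MX
      η-Mt : ∀ X → M₁ (t X) ∘ η X ≡ M₁ π₂ ∘ (α ⊤ X ∘ ⟨ M₁ ! , t X ⟩)
      η-r  : ∀ X → η X ∘ r X ≡ r (M X) ∘ r X

  module _ (E : PathObjectCategory) where
    open PathObjectCategory E

    record Homotopy {X Y : Obj} (f g : Hom X Y) : Set ℓ where
      field
        map : Hom X (M Y)
        src : s Y ∘ map ≡ f
        tgt : t Y ∘ map ≡ g

    record SDRStr {X Y : Obj} (f : Hom X Y) : Set ℓ where
      field
        k     : Hom Y X
        k∘f   : k ∘ f ≡ id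
        θ     : Homotopy id (f ∘ k)
        θ-f   : Homotopy.map θ ∘ f ≡ r Y ∘ f

module Submission where

-- The cloven w.f.s. of a path object category is the mapping path
-- factorisation  f = ρ_f ∘ λ_f  through  Pf = X ×_{f,t} MY,  whose points are
-- pairs (x, γ) of a point of X and a path γ ending at f x; λ_f x = (x, r (f x))
-- and ρ_f (x, γ) = s γ.  The fillers come from the path-object structure:
-- π_f ((x, γ), δ) = (x, γ · δ) uses composition m, and σ_f (x, γ) = ((x, γ), Γ)
-- where the path Γ contracts (x, γ) onto λ_f x, with X-component a constant
-- path at x (built with the strength α) and MY-component η γ.  A section of ρ_f
-- extending λ_f is a map Y → Pf, i.e. a pair (k, θ) with θ y a path from y to
-- f (k y), subject to k f = 1 and θ f = r f: a strong deformation retraction.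

open import Defs
open import Data.Product using (Σ; _,_)
open import Function.Bundles using (_↔_; mk↔ₛ′)
open import Relation.Binary.PropositionalEquality using (_≡_; refl; sym; trans; cong; cong₂; module ≡-Reasoning)
open import Axiom.UniquenessOfIdentityProofs.WithK using (uip)

module CategoryFacts {o ℓ} (𝒞 : Category o ℓ) where
  open Category 𝒞

  pullˡ : ∀ {A B C Z} {a : Hom B C} {b : Hom A B} {c : Hom A C} {u : Hom Z A} →
          a ∘ b ≡ c → a ∘ (b ∘ u) ≡ c ∘ u
  pullˡ {u = u} e = trans (sym assoc) (cong (_∘ u) e)

  pullʳ : ∀ {A B C Z} {a : Hom B C} {b : Hom A B} {u : Hom Z A} {c : Hom Z B} →
          b ∘ u ≡ c → (a ∘ b) ∘ u ≡ a ∘ c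
  pullʳ {a = a} e = trans assoc (cong (a ∘_) e)

  cancelˡ : ∀ {A B Z} {a : Hom B A} {b : Hom A B} {u : Hom Z A} →
            a ∘ b ≡ id → a ∘ (b ∘ u) ≡ u
  cancelˡ e = trans (pullˡ e) identityˡ

  cancelʳ : ∀ {A B C} {a : Hom B C} {b : Hom A B} {u : Hom B A} →
            b ∘ u ≡ id → (a ∘ b) ∘ u ≡ a
  cancelʳ e = trans (pullʳ e) identityʳ

module PullbackFacts {o ℓ} (𝒞 : Category o ℓ) {P A B C : Category.Obj 𝒞}
    {f : Category.Hom 𝒞 A C} {g : Category.Hom 𝒞 B C}
    {p₁ : Category.Hom 𝒞 P A} {p₂ : Category.Hom 𝒞 P B}
    (pb : IsPullback 𝒞 f g p₁ p₂) where
  open Category 𝒞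
  open CategoryFacts 𝒞
  open IsPullback pb

  ext : ∀ {Z} {u v : Hom Z P} → p₁ ∘ u ≡ p₁ ∘ v → p₂ ∘ u ≡ p₂ ∘ v → u ≡ v
  ext {v = v} e₁ e₂ =
    trans (unique commute∘v _ e₁ e₂) (sym (unique commute∘v v refl refl))
    where
      commute∘v : f ∘ (p₁ ∘ v) ≡ g ∘ (p₂ ∘ v)
      commute∘v = trans (pullˡ commute) assoc

module ProductFacts {o ℓ} (𝒞 : Category o ℓ) (fc : FinitelyComplete 𝒞) where
  open Category 𝒞
  open CategoryFacts 𝒞
  open FCNotation 𝒞 fc

  π₁-⟨⟩ : ∀ {Z A B} {a : Hom Z A} {b : Hom Z B} → π₁ ∘ ⟨ a , b ⟩ ≡ a
  π₁-⟨⟩ {A = A} {B} = Product.π₁∘⟨⟩ (FinitelyComplete.product fc A B)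

  π₂-⟨⟩ : ∀ {Z A B} {a : Hom Z A} {b : Hom Z B} → π₂ ∘ ⟨ a , b ⟩ ≡ b
  π₂-⟨⟩ {A = A} {B} = Product.π₂∘⟨⟩ (FinitelyComplete.product fc A B)

  ⟨⟩-∘ : ∀ {W Z A B} {a : Hom Z A} {b : Hom Z B} {u : Hom W Z} →
         ⟨ a , b ⟩ ∘ u ≡ ⟨ a ∘ u , b ∘ u ⟩
  ⟨⟩-∘ {A = A} {B} {a} {b} {u} =
    Product.⟨⟩-unique (FinitelyComplete.product fc A B) (⟨ a , b ⟩ ∘ u)
      (pullˡ π₁-⟨⟩) (pullˡ π₂-⟨⟩)

  ⊗-⟨⟩ : ∀ {Z A B A' B'} {a : Hom A A'} {b : Hom B B'} {c : Hom Z A} {d : Hom Z B} →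
         (a ⊗ b) ∘ ⟨ c , d ⟩ ≡ ⟨ a ∘ c , b ∘ d ⟩
  ⊗-⟨⟩ = trans ⟨⟩-∘ (cong₂ ⟨_,_⟩ (pullʳ π₁-⟨⟩) (pullʳ π₂-⟨⟩))

module PathFacts {o ℓ} (𝒞 : Category o ℓ) (fc : FinitelyComplete 𝒞)
    (E : PathObjectCategory 𝒞 fc) where
  open Category 𝒞
  open CategoryFacts 𝒞
  open FCNotation 𝒞 fc
  open ProductFacts 𝒞 fc
  open PathObjectCategory E

  composable : ∀ Y → IsPullback 𝒞 (s Y) (t Y) (pb₁ (s Y) (t Y)) (pb₂ (s Y) (t Y))
  composable Y = Pullback.isPullback (FinitelyComplete.pullback fc (s Y) (t Y))

  -- the composite path a · b ("a after b"), defined when a starts where b ends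
  _·_⟨_⟩ : ∀ {Z Y} (a b : Hom Z (M Y)) → s Y ∘ a ≡ t Y ∘ b → Hom Z (M Y)
  _·_⟨_⟩ {Y = Y} a b e = m Y ∘ IsPullback.universal (composable Y) a b e

  ·-s : ∀ {Z Y} {a b : Hom Z (M Y)} (e : s Y ∘ a ≡ t Y ∘ b) → s Y ∘ (a · b ⟨ e ⟩) ≡ s Y ∘ b
  ·-s {Y = Y} e = trans (pullˡ (s-m Y)) (pullʳ (IsPullback.p₂∘universal (composable Y) e))

  ·-t : ∀ {Z Y} {a b : Hom Z (M Y)} (e : s Y ∘ a ≡ t Y ∘ b) → t Y ∘ (a · b ⟨ e ⟩) ≡ t Y ∘ a
  ·-t {Y = Y} e = trans (pullˡ (t-m Y)) (pullʳ (IsPullback.p₁∘universal (composable Y) e))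

  ·-unitʳ : ∀ {W Z Y} {a b : Hom Z (M Y)} (e : s Y ∘ a ≡ t Y ∘ b) {u : Hom W Z} →
            b ∘ u ≡ r Y ∘ (s Y ∘ (a ∘ u)) → (a · b ⟨ e ⟩) ∘ u ≡ a ∘ u
  ·-unitʳ {Y = Y} {a} e {u} b∘u-const = trans assoc
    (m-unitʳ (a ∘ u) _ (pullˡ (IsPullback.p₁∘universal (composable Y) e))
                       (trans (pullˡ (IsPullback.p₂∘universal (composable Y) e)) b∘u-const))

  -- The constant path at b, of "shape" a : a path in the terminal object
  -- transported into X by the strength.  For a = r ⊤ ∘ c it is r X ∘ b
  -- (const-r); for a = M₁ ! it describes M₁ (t X) ∘ η X (axiom η-Mt).
  const : ∀ {Z X} → Hom Z (M ⊤) → Hom Z X → Hom Z (M X)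
  const {X = X} a b = M₁ π₂ ∘ (α ⊤ X ∘ ⟨ a , b ⟩)

  private
    π₂-⊗id-⟨⟩ : ∀ {Z A A' X} {φ : Hom A A'} {a : Hom Z A} {b : Hom Z X} →
                π₂ ∘ ((φ ⊗ id) ∘ ⟨ a , b ⟩) ≡ b
    π₂-⊗id-⟨⟩ = trans (cong (π₂ ∘_) ⊗-⟨⟩) (trans π₂-⟨⟩ identityˡ)

  const-s : ∀ {Z X} (a : Hom Z (M ⊤)) (b : Hom Z X) → s X ∘ const a b ≡ b
  const-s {X = X} a b =
    trans (pullˡ (s-nat π₂)) (trans assoc (trans (cong (π₂ ∘_) (pullˡ (s-strong ⊤ X))) π₂-⊗id-⟨⟩))

  const-t : ∀ {Z X} (a : Hom Z (M ⊤)) (b : Hom Z X) → t X ∘ const a b ≡ b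
  const-t {X = X} a b =
    trans (pullˡ (t-nat π₂)) (trans assoc (trans (cong (π₂ ∘_) (pullˡ (t-strong ⊤ X))) π₂-⊗id-⟨⟩))

  const-∘ : ∀ {W Z X} (a : Hom Z (M ⊤)) (b : Hom Z X) (u : Hom W Z) →
            const a b ∘ u ≡ const (a ∘ u) (b ∘ u)
  const-∘ a b u = trans assoc (cong (M₁ π₂ ∘_) (trans assoc (cong (α ⊤ _ ∘_) ⟨⟩-∘)))

  const-nat : ∀ {Z X Y} (f : Hom X Y) (a : Hom Z (M ⊤)) (b : Hom Z X) →
              M₁ f ∘ const a b ≡ const a (f ∘ b)
  const-nat {X = X} {Y} f a b = begin
    M₁ f ∘ (M₁ π₂ ∘ (α ⊤ X ∘ ⟨ a , b ⟩))
      ≡⟨ pullˡ (sym M-∘) ⟩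
    M₁ (f ∘ π₂) ∘ (α ⊤ X ∘ ⟨ a , b ⟩)
      ≡⟨ cong (λ z → M₁ z ∘ (α ⊤ X ∘ ⟨ a , b ⟩)) (sym π₂-⟨⟩) ⟩
    M₁ (π₂ ∘ (id ⊗ f)) ∘ (α ⊤ X ∘ ⟨ a , b ⟩)
      ≡⟨ trans (cong (_∘ (α ⊤ X ∘ ⟨ a , b ⟩)) M-∘) assoc ⟩
    M₁ π₂ ∘ (M₁ (id ⊗ f) ∘ (α ⊤ X ∘ ⟨ a , b ⟩))
      ≡⟨ cong (M₁ π₂ ∘_) (trans (pullˡ (α-nat id f)) assoc) ⟩
    M₁ π₂ ∘ (α ⊤ Y ∘ ((M₁ id ⊗ f) ∘ ⟨ a , b ⟩))
      ≡⟨ cong (λ z → M₁ π₂ ∘ (α ⊤ Y ∘ z))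
              (trans ⊗-⟨⟩ (cong (⟨_, f ∘ b ⟩) (trans (cong (_∘ a) M-id) identityˡ))) ⟩
    M₁ π₂ ∘ (α ⊤ Y ∘ ⟨ a , f ∘ b ⟩) ∎
    where open ≡-Reasoning

  const-r : ∀ {Z X} (c : Hom Z ⊤) (b : Hom Z X) → const (r ⊤ ∘ c) b ≡ r X ∘ b
  const-r {X = X} c b = begin
    M₁ π₂ ∘ (α ⊤ X ∘ ⟨ r ⊤ ∘ c , b ⟩)
      ≡⟨ cong (λ z → M₁ π₂ ∘ (α ⊤ X ∘ z)) (sym (trans ⊗-⟨⟩ (cong (⟨ r ⊤ ∘ c ,_⟩) identityˡ))) ⟩
    M₁ π₂ ∘ (α ⊤ X ∘ ((r ⊤ ⊗ id) ∘ ⟨ c , b ⟩))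
      ≡⟨ cong (M₁ π₂ ∘_) (pullˡ (r-strong ⊤ X)) ⟩
    M₁ π₂ ∘ (r (⊤ × X) ∘ ⟨ c , b ⟩)
      ≡⟨ trans (pullˡ (r-nat π₂)) (pullʳ π₂-⟨⟩) ⟩
    r X ∘ b ∎
    where open ≡-Reasoning

  s-nat∘ : ∀ {Z X Y} (f : Hom X Y) {u : Hom Z (M X)} → f ∘ (s X ∘ u) ≡ s Y ∘ (M₁ f ∘ u)
  s-nat∘ f = trans (pullˡ (sym (s-nat f))) assoc

  t-nat∘ : ∀ {Z X Y} (f : Hom X Y) {u : Hom Z (M X)} → f ∘ (t X ∘ u) ≡ t Y ∘ (M₁ f ∘ u)
  t-nat∘ f = trans (pullˡ (sym (t-nat f))) assoc

module MappingPathFactorisation {o ℓ} (𝒞 : Category o ℓ) (fc : FinitelyComplete 𝒞)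
    (E : PathObjectCategory 𝒞 fc) where
  open Category 𝒞
  open CategoryFacts 𝒞
  open FCNotation 𝒞 fc
  open PathObjectCategory E
  open PathFacts 𝒞 fc E

  module _ {X Y : Obj} (f : Hom X Y) where
    isPf : IsPullback 𝒞 f (t Y) (pb₁ f (t Y)) (pb₂ f (t Y))
    isPf = Pullback.isPullback (FinitelyComplete.pullback fc f (t Y))

    Pf : Obj
    Pf = PB f (t Y)

    base : Hom Pf X
    base = pb₁ f (t Y)

    path : Hom Pf (M Y)
    path = pb₂ f (t Y)

    base-path : f ∘ base ≡ t Y ∘ path
    base-path = IsPullback.commute isPf

    mkPf : ∀ {Z} (x : Hom Z X) (γ : Hom Z (M Y)) → f ∘ x ≡ t Y ∘ γ → Hom Z Pf
    mkPf = IsPullback.universal isPf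

    mkPf-base : ∀ {Z} {x : Hom Z X} {γ : Hom Z (M Y)} (e : f ∘ x ≡ t Y ∘ γ) → base ∘ mkPf x γ e ≡ x
    mkPf-base = IsPullback.p₁∘universal isPf

    mkPf-path : ∀ {Z} {x : Hom Z X} {γ : Hom Z (M Y)} (e : f ∘ x ≡ t Y ∘ γ) → path ∘ mkPf x γ e ≡ γ
    mkPf-path = IsPullback.p₂∘universal isPf

    Pf-ext : ∀ {Z} {u v : Hom Z Pf} → base ∘ u ≡ base ∘ v → path ∘ u ≡ path ∘ v → u ≡ v
    Pf-ext = PullbackFacts.ext 𝒞 isPf

    private
      lam-ok : f ∘ id ≡ t Y ∘ (r Y ∘ f)
      lam-ok = trans identityʳ (sym (cancelˡ (t-r Y)))

    lam : Hom X Pf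
    lam = mkPf id (r Y ∘ f) lam-ok

    rho : Hom Pf Y
    rho = s Y ∘ path

    lam-base : base ∘ lam ≡ id
    lam-base = mkPf-base lam-ok

    lam-path : path ∘ lam ≡ r Y ∘ f
    lam-path = mkPf-path lam-ok

    fact : rho ∘ lam ≡ f
    fact = trans (pullʳ lam-path) (cancelˡ (s-r Y))

  module _ {X Y X' Y'} {f : Hom X Y} {g : Hom X' Y'} (h : Hom X X') (k : Hom Y Y')
           (sq : g ∘ h ≡ k ∘ f) where
    private
      Pmap-ok : g ∘ (h ∘ base f) ≡ t Y' ∘ (M₁ k ∘ path f)
      Pmap-ok = begin
        g ∘ (h ∘ base f)   ≡⟨ pullˡ sq ⟩
        (k ∘ f) ∘ base f   ≡⟨ pullʳ (base-path f) ⟩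
        k ∘ (t Y ∘ path f) ≡⟨ t-nat∘ k ⟩
        t Y' ∘ (M₁ k ∘ path f) ∎
        where open ≡-Reasoning

    Pmap : Hom (Pf f) (Pf g)
    Pmap = mkPf g (h ∘ base f) (M₁ k ∘ path f) Pmap-ok

    Pmap-base : base g ∘ Pmap ≡ h ∘ base f
    Pmap-base = mkPf-base g Pmap-ok

    Pmap-path : path g ∘ Pmap ≡ M₁ k ∘ path f
    Pmap-path = mkPf-path g Pmap-ok

    Pmap-lam : Pmap ∘ lam f ≡ lam g ∘ h
    Pmap-lam = Pf-ext g
      (trans (trans (pullˡ Pmap-base) (cancelʳ (lam-base f))) (sym (cancelˡ (lam-base g))))
      (begin
        path g ∘ (Pmap ∘ lam f)    ≡⟨ trans (pullˡ Pmap-path) (pullʳ (lam-path f)) ⟩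
        M₁ k ∘ (r Y ∘ f)           ≡⟨ trans (pullˡ (r-nat k)) (pullʳ (sym sq)) ⟩
        r Y' ∘ (g ∘ h)             ≡⟨ sym (trans (pullˡ (lam-path g)) assoc) ⟩
        path g ∘ (lam g ∘ h)       ∎)
      where open ≡-Reasoning

    rho-Pmap : rho g ∘ Pmap ≡ k ∘ rho f
    rho-Pmap = trans (pullʳ Pmap-path) (sym (s-nat∘ k))

  Pmap-id : ∀ {X Y} {f : Hom X Y} (sq : f ∘ id ≡ id ∘ f) → Pmap id id sq ≡ id
  Pmap-id {f = f} sq = Pf-ext f
    (trans (Pmap-base id id sq) (trans identityˡ (sym identityʳ)))
    (trans (Pmap-path id id sq) (trans (cong (_∘ path f) M-id) (trans identityˡ (sym identityʳ))))

  Pmap-∘ : ∀ {X Y X' Y' X'' Y''} {f : Hom X Y} {g : Hom X' Y'} {e : Hom X'' Y''}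
           {h : Hom X X'} {k : Hom Y Y'} {h' : Hom X' X''} {k' : Hom Y' Y''}
           (sq : g ∘ h ≡ k ∘ f) (sq' : e ∘ h' ≡ k' ∘ g)
           (sq'' : e ∘ (h' ∘ h) ≡ (k' ∘ k) ∘ f) →
           Pmap (h' ∘ h) (k' ∘ k) sq'' ≡ Pmap h' k' sq' ∘ Pmap h k sq
  Pmap-∘ {f = f} {e = e} {h} {k} {h'} {k'} sq sq' sq'' = Pf-ext e
    (trans (Pmap-base _ _ sq'') (trans assoc
      (sym (trans (pullˡ (Pmap-base _ _ sq')) (pullʳ (Pmap-base _ _ sq))))))
    (trans (Pmap-path _ _ sq'') (trans (cong (_∘ path f) M-∘) (trans assoc
      (sym (trans (pullˡ (Pmap-path _ _ sq')) (pullʳ (Pmap-path _ _ sq)))))))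

  module Composition {X Y} (f : Hom X Y) where
    private
      γ : Hom (Pf (rho f)) (M Y)
      γ = path f ∘ base (rho f)

      δ : Hom (Pf (rho f)) (M Y)
      δ = path (rho f)

      γδ-composable : s Y ∘ γ ≡ t Y ∘ δ
      γδ-composable = trans (sym assoc) (base-path (rho f))

      π-ok : f ∘ (base f ∘ base (rho f)) ≡ t Y ∘ (γ · δ ⟨ γδ-composable ⟩)
      π-ok = trans (pullˡ (base-path f)) (trans assoc (sym (·-t γδ-composable)))

    π : Hom (Pf (rho f)) (Pf f)
    π = mkPf f (base f ∘ base (rho f)) (γ · δ ⟨ γδ-composable ⟩) π-ok

    -- composing with the constant path λ_{ρ_f} changes nothing
    π-lam : π ∘ lam (rho f) ≡ id
    π-lam = Pf-ext f
      (trans (pullˡ (mkPf-base f π-ok)) (trans (cancelʳ (lam-base (rho f))) (sym identityʳ)))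
      (trans (pullˡ (mkPf-path f π-ok))
        (trans (·-unitʳ γδ-composable (trans (lam-path (rho f)) (cong (λ z → r Y ∘ (s Y ∘ z)) (sym γ-lam))))
          (trans γ-lam (sym identityʳ))))
      where
        γ-lam : γ ∘ lam (rho f) ≡ path f
        γ-lam = cancelʳ (lam-base (rho f))

    rho-π : rho f ∘ π ≡ rho (rho f)
    rho-π = trans (pullʳ (mkPf-path f π-ok)) (·-s γδ-composable)

  -- The contraction Γ : Pf → M(Pf), a path in Pf from (x, γ) to λ_f x.  Its
  -- X-component is the constant path at x shaped by M₁ ! γ, its MY-component is
  -- η γ; axiom η-Mt is exactly what makes the two components fit together.
  module Contraction {X Y} (f : Hom X Y) where
    -- M preserves the pullback square defining Pf, so M(Pf) = MX ×_{MY} MMY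
    M-isPf : IsPullback 𝒞 (M₁ f) (M₁ (t Y)) (M₁ (base f)) (M₁ (path f))
    M-isPf = M-pullback (isPf f)

    Γ-base : Hom (Pf f) (M X)
    Γ-base = const (M₁ ! ∘ path f) (base f)

    Γ-path : Hom (Pf f) (M (M Y))
    Γ-path = η Y ∘ path f

    Γ-ok : M₁ f ∘ Γ-base ≡ M₁ (t Y) ∘ Γ-path
    Γ-ok = begin
      M₁ f ∘ const (M₁ ! ∘ path f) (base f)  ≡⟨ const-nat f _ _ ⟩
      const (M₁ ! ∘ path f) (f ∘ base f)     ≡⟨ cong (const _) (base-path f) ⟩
      const (M₁ ! ∘ path f) (t Y ∘ path f)   ≡⟨ sym (const-∘ (M₁ !) (t Y) (path f)) ⟩
      const (M₁ !) (t Y) ∘ path f            ≡⟨ cong (_∘ path f) (sym (η-Mt Y)) ⟩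
      (M₁ (t Y) ∘ η Y) ∘ path f              ≡⟨ assoc ⟩
      M₁ (t Y) ∘ (η Y ∘ path f)              ∎
      where open ≡-Reasoning

    Γ : Hom (Pf f) (M (Pf f))
    Γ = IsPullback.universal M-isPf Γ-base Γ-path Γ-ok

    M-base-Γ : M₁ (base f) ∘ Γ ≡ Γ-base
    M-base-Γ = IsPullback.p₁∘universal M-isPf Γ-ok

    M-path-Γ : M₁ (path f) ∘ Γ ≡ Γ-path
    M-path-Γ = IsPullback.p₂∘universal M-isPf Γ-ok

    Γ-s : s (Pf f) ∘ Γ ≡ id
    Γ-s = Pf-ext f
      (trans (s-nat∘ (base f)) (trans (cong (s X ∘_) M-base-Γ) (trans (const-s _ _) (sym identityʳ))))
      (trans (s-nat∘ (path f)) (trans (cong (s (M Y) ∘_) M-path-Γ) (trans (cancelˡ (η-s Y)) (sym identityʳ))))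

    Γ-t : t (Pf f) ∘ Γ ≡ lam f ∘ base f
    Γ-t = Pf-ext f
      (trans (t-nat∘ (base f)) (trans (cong (t X ∘_) M-base-Γ)
        (trans (const-t _ _) (sym (cancelˡ (lam-base f))))))
      (begin
        path f ∘ (t (Pf f) ∘ Γ)     ≡⟨ trans (t-nat∘ (path f)) (cong (t (M Y) ∘_) M-path-Γ) ⟩
        t (M Y) ∘ (η Y ∘ path f)    ≡⟨ trans (pullˡ (η-t Y)) assoc ⟩
        r Y ∘ (t Y ∘ path f)        ≡⟨ cong (r Y ∘_) (sym (base-path f)) ⟩
        r Y ∘ (f ∘ base f)          ≡⟨ sym (trans (pullˡ (lam-path f)) assoc) ⟩
        path f ∘ (lam f ∘ base f)   ∎)
      where open ≡-Reasoning

    Γ-lam : Γ ∘ lam f ≡ r (Pf f) ∘ lam f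
    Γ-lam = PullbackFacts.ext 𝒞 M-isPf
      (begin
        M₁ (base f) ∘ (Γ ∘ lam f)              ≡⟨ pullˡ M-base-Γ ⟩
        const (M₁ ! ∘ path f) (base f) ∘ lam f  ≡⟨ const-∘ _ _ _ ⟩
        const ((M₁ ! ∘ path f) ∘ lam f) (base f ∘ lam f)
          ≡⟨ cong₂ const (trans (pullʳ (lam-path f)) (trans (pullˡ (r-nat !)) assoc)) (lam-base f) ⟩
        const (r ⊤ ∘ (! ∘ f)) id                ≡⟨ const-r _ _ ⟩
        r X ∘ id                                ≡⟨ cong (r X ∘_) (sym (lam-base f)) ⟩
        r X ∘ (base f ∘ lam f)                  ≡⟨ sym (trans (pullˡ (r-nat (base f))) assoc) ⟩
        M₁ (base f) ∘ (r (Pf f) ∘ lam f)        ∎)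
      (begin
        M₁ (path f) ∘ (Γ ∘ lam f)               ≡⟨ trans (pullˡ M-path-Γ) (pullʳ (lam-path f)) ⟩
        η Y ∘ (r Y ∘ f)                         ≡⟨ trans (pullˡ (η-r Y)) assoc ⟩
        r (M Y) ∘ (r Y ∘ f)                     ≡⟨ cong (r (M Y) ∘_) (sym (lam-path f)) ⟩
        r (M Y) ∘ (path f ∘ lam f)              ≡⟨ sym (trans (pullˡ (r-nat (path f))) assoc) ⟩
        M₁ (path f) ∘ (r (Pf f) ∘ lam f)        ∎)
      where open ≡-Reasoning

    σ : Hom (Pf f) (Pf (lam f))
    σ = mkPf (lam f) (base f) Γ (sym Γ-t)

    σ-lam : σ ∘ lam f ≡ lam (lam f)
    σ-lam = Pf-ext (lam f)
      (trans (pullˡ (mkPf-base (lam f) (sym Γ-t))) (trans (lam-base f) (sym (lam-base (lam f)))))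
      (trans (pullˡ (mkPf-path (lam f) (sym Γ-t))) (trans Γ-lam (sym (lam-path (lam f)))))

    rho-σ : rho (lam f) ∘ σ ≡ id
    rho-σ = trans (pullʳ (mkPf-path (lam f) (sym Γ-t))) Γ-s

  mappingPathWFS : ClovenWFS 𝒞
  mappingPathWFS = record
    { P = Pf ; lam = lam ; rho = rho ; fact = fact
    ; Pmap = Pmap ; Pmap-lam = λ sq → Pmap-lam _ _ sq ; rho-Pmap = λ sq → rho-Pmap _ _ sq
    ; Pmap-id = Pmap-id ; Pmap-∘ = Pmap-∘
    ; σ = Contraction.σ ; σ-lam = Contraction.σ-lam ; rho-σ = Contraction.rho-σ
    ; π = Composition.π ; π-lam = Composition.π-lam ; rho-π = Composition.rho-π }

  module _ {X Y} (f : Hom X Y) where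
    LMap→SDR : LMapStr 𝒞 mappingPathWFS f → SDRStr 𝒞 fc E f
    LMap→SDR L = record
      { k   = base f ∘ sec
      ; k∘f = trans (pullʳ sec-lam) (lam-base f)
      ; θ   = record
        { map = path f ∘ sec
        ; src = trans (sym assoc) rho-sec
        ; tgt = trans (sym assoc) (trans (cong (_∘ sec) (sym (base-path f))) assoc) }
      ; θ-f = trans (pullʳ sec-lam) (lam-path f) }
      where open LMapStr L

    SDR→LMap : SDRStr 𝒞 fc E f → LMapStr 𝒞 mappingPathWFS f
    SDR→LMap D = record
      { sec     = mkPf f k (Homotopy.map θ) θ-ok
      ; sec-lam = Pf-ext f
          (trans (pullˡ (mkPf-base f θ-ok)) (trans k∘f (sym (lam-base f))))
          (trans (pullˡ (mkPf-path f θ-ok)) (trans θ-f (sym (lam-path f))))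
      ; rho-sec = trans (pullʳ (mkPf-path f θ-ok)) (Homotopy.src θ) }
      where
        open SDRStr D
        θ-ok : f ∘ k ≡ t Y ∘ Homotopy.map θ
        θ-ok = sym (Homotopy.tgt θ)

    -- both structures are determined by their data (hom-sets satisfy UIP)
    SDR-ext : (D₁ D₂ : SDRStr 𝒞 fc E f) → SDRStr.k D₁ ≡ SDRStr.k D₂ →
              Homotopy.map (SDRStr.θ D₁) ≡ Homotopy.map (SDRStr.θ D₂) → D₁ ≡ D₂
    SDR-ext record { k = k ; k∘f = a ; θ = record { map = θ ; src = b ; tgt = c } ; θ-f = d }
            record { k = .k ; k∘f = a' ; θ = record { map = .θ ; src = b' ; tgt = c' } ; θ-f = d' }
            refl refl rewrite uip a a' | uip b b' | uip c c' | uip d d' = refl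

    LMap-ext : (L₁ L₂ : LMapStr 𝒞 mappingPathWFS f) → LMapStr.sec L₁ ≡ LMapStr.sec L₂ → L₁ ≡ L₂
    LMap-ext record { sec = sec ; sec-lam = a ; rho-sec = b }
             record { sec = .sec ; sec-lam = a' ; rho-sec = b' }
             refl rewrite uip a a' | uip b b' = refl

    LMap↔SDR : LMapStr 𝒞 mappingPathWFS f ↔ SDRStr 𝒞 fc E f
    LMap↔SDR = mk↔ₛ′ LMap→SDR SDR→LMap
      (λ D → SDR-ext (LMap→SDR (SDR→LMap D)) D (mkPf-base f _) (mkPf-path f _))
      (λ L → LMap-ext (SDR→LMap (LMap→SDR L)) L (Pf-ext f (mkPf-base f _) (mkPf-path f _)))

proposition6p4 : ∀ {o ℓ} (𝒞 : Category o ℓ) (fc : FinitelyComplete 𝒞)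
                   (E : PathObjectCategory 𝒞 fc) →
                   Σ (ClovenWFS 𝒞) (λ W →
                     ∀ {X Y} (f : Category.Hom 𝒞 X Y) →
                       LMapStr 𝒞 W f ↔ SDRStr 𝒞 fc E f)
proposition6p4 𝒞 fc E = mappingPathWFS , LMap↔SDR
  where open MappingPathFactorisation 𝒞 fc E
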